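{- For all $\Sigma,\Gamma\in Sat(\mathsf{BQL}_{\mathsf{CD}})$: if $\Sigma\prec\Gamma$ then $\Sigma\subseteq\Gamma$.
   Context: Standing assumption: $\mathcal{L}$ is a countable first-order language whose formulas are built from atomic formulas, $\top$ and $\bot$ using exactly $\wedge,\vee,\rightarrow,\forall,\exists$; $\mathcal{L}^+=\mathcal{L}\cup\{a_i\}_{i\in\omega}$ with the $a_i$ fresh constant symbols; $\phi(t)$ denotes substitution of $t$ for the free variable $v$. The natural deduction system $\mathcal{N}\mathsf{BQL}_{\mathsf{CD}}$ consists of trees of (possibly discharged) $\mathcal{L}^+$-sentences built with the following rules, where all displayed formulas are sentences (so e.g. in CD, $v$ is not free in $\phi$) and $t$ ranges over closed $\mathcal{L}^+$-terms: ($\top$-Int) $\top$ may be placed at a leaf as an already-discharged assumption; ($\bot$-Elim) from $\bot$ infer $\phi$; ($\wedge$-Int) from $\phi,\psi$ infer $\phi\wedge\psi$; ($\wedge$-Elim) from $\phi\wedge\psi$ infer $\phi$, or infer $\psi$; ($\vee$-Int) from $\phi$ or from $\psi$ infer $\phi\vee\psi$; ($\vee$-Elim) from $\phi\vee\psi$, a derivation of $\chi$ from assumption $\phi$ and a derivation of $\chi$ from assumption $\psi$, infer $\chi$, discharging those assumptions; ($\rightarrow$-Int) from a derivation of $\psi$ from assumption $\phi$ infer $\phi\rightarrow\psi$, discharging $\phi$; (Internal Transitivity) from $\phi\rightarrow\psi$ and $\psi\rightarrow\chi$ infer $\phi\rightarrow\chi$; (Internal $\wedge$-Int) from $\phi\rightarrow\psi$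 and $\phi\rightarrow\chi$ infer $\phi\rightarrow\psi\wedge\chi$; (Internal $\vee$-Elim) from $\phi\rightarrow\chi$ and $\psi\rightarrow\chi$ infer $\phi\vee\psi\rightarrow\chi$; (Internal $\forall$-Int) from $\forall v(\phi\rightarrow\psi)$ infer $\phi\rightarrow\forall v\psi$; (Internal $\exists$-Elim) from $\forall v(\phi\rightarrow\psi)$ infer $\exists v\phi\rightarrow\psi$; ($\forall$-Int) from $\phi(a_i)$ infer $\forall v\phi$, provided $a_i$ occurs neither in $\phi$ nor in any open assumption of the derivation of $\phi(a_i)$; ($\forall$-Elim) from $\forall v\phi$ infer $\phi(t)$; (CD) from $\forall v(\phi\vee\psi)$ infer $\phi\vee\forall v\psi$; ($\exists$-Int) from $\phi(t)$ infer $\exists v\phi$; ($\exists$-Elim) from $\exists v\phi$ and a derivation of $\psi$ from assumption $\phi(a_i)$ infer $\psi$, discharging $\phi(a_i)$, provided $a_i$ occurs neither in $\phi$, nor in $\psi$, nor in any open assumption other than $\phi(a_i)$ of that derivation. There is no modus ponens rule. $\Gamma\vdash\phi$ means there is such a tree with root $\phi$ all of whose open assumptions lie in $\Gamma$. A set $\Theta$ of $\mathcal{L}^+$-sentences is a prime saturated $\mathsf{BQL}_{\mathsf{CD}}$-theory iff: $\bot\notin\Theta$; if $\Theta\vdash\phi$ then $\phi\in\Theta$; if $\phi\vee\psi\in\Theta$ then $\phi\in\Theta$ or $\psi\in\Theta$; if $\exists v\phi\in\Theta$ then $\phi(t)\in\Theta$ for some closed $\mathcal{L}^+$-term $t$;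 if $\phi(t)\in\Theta$ for every closed $\mathcal{L}^+$-term $t$ then $\forall v\phi\in\Theta$. $Sat(\mathsf{BQL}_{\mathsf{CD}})$ is the set of these. For $\Sigma,\Gamma\in Sat(\mathsf{BQL}_{\mathsf{CD}})$, $\Sigma\prec\Gamma$ iff for all $\mathcal{L}^+$-sentences $\phi,\psi$: if $\phi\rightarrow\psi\in\Sigma$ and $\phi\in\Gamma$ then $\psi\in\Gamma$. -}

module Defs where

open import Data.Nat using (ℕ; zero; suc)
open import Data.Fin using (Fin; zero; suc)
open import Data.Vec using (Vec; []; _∷_)
open import Data.Product using (Σ; _×_; _,_; ∃)
open import Data.Sum using (_⊎_)
open import Data.Empty using (⊥)
open import Relation.Binary.PropositionalEquality using (_≡_)
open import Relation.Nullary using (¬_)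
open import Function.Definitions using (Injective)

-- A countable first-order signature: function symbols (constants are
-- 0-ary function symbols) and relation symbols, each with an arity, and
-- both symbol sets countable (injectively coded by ℕ).
record Language : Set₁ where
  field
    Fun         : Set
    Rel         : Set
    funArity    : Fun → ℕ
    relArity    : Rel → ℕ
    funCode     : Fun → ℕ
    funCode-inj : Injective _≡_ _≡_ funCode
    relCode     : Rel → ℕ
    relCode-inj : Injective _≡_ _≡_ relCode

module Syntax (L : Language) where
  open Language L

  -- L⁺-terms with n free (de Bruijn) variables; 'con i' is the fresh constant a_i.
  data Term (n : ℕ) : Set where
    var : Fin n → Term n
    con : ℕ → Term n
    app : (f : Fun) → Vec (Term n) (funArity f) → Term n

  mutual
    substT : ∀ {n m} → (Fin n → Term m) → Term n → Term m
    substT σ (var x)    = σ x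
    substT σ (con i)    = con i
    substT σ (app f ts) = app f (substTs σ ts)

    substTs : ∀ {n m k} → (Fin n → Term m) → Vec (Term n) k → Vec (Term m) k
    substTs σ []       = []
    substTs σ (t ∷ ts) = substT σ t ∷ substTs σ ts

  lift : ∀ {n m} → (Fin n → Term m) → Fin (suc n) → Term (suc m)
  lift σ zero    = var zero
  lift σ (suc x) = substT (λ y → var (suc y)) (σ x)

  infixr 6 _∧'_
  infixr 5 _∨'_
  infixr 4 _⇒_
  data Formula (n : ℕ) : Set where
    atom  : (R : Rel) → Vec (Term n) (relArity R) → Formula n
    ⊤'    : Formula n
    ⊥'    : Formula n
    _∧'_  : Formula n → Formula n → Formula n
    _∨'_  : Formula n → Formula n → Formula n
    _⇒_   : Formula n → Formula n → Formula n
    ∀'    : Formula (suc n) → Formula n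
    ∃'    : Formula (suc n) → Formula n

  substF : ∀ {n m} → (Fin n → Term m) → Formula n → Formula m
  substF σ (atom R ts) = atom R (substTs σ ts)
  substF σ ⊤'          = ⊤'
  substF σ ⊥'          = ⊥'
  substF σ (φ ∧' ψ)    = substF σ φ ∧' substF σ ψ
  substF σ (φ ∨' ψ)    = substF σ φ ∨' substF σ ψ
  substF σ (φ ⇒ ψ)     = substF σ φ ⇒ substF σ ψ
  substF σ (∀' φ)      = ∀' (substF (lift σ) φ)
  substF σ (∃' φ)      = ∃' (substF (lift σ) φ)

  Sentence : Set
  Sentence = Formula 0

  _[_] : Formula 1 → Term 0 → Sentence
  φ [ t ] = substF (λ { zero → t }) φ

  wk : Sentence → Formula 1
  wk = substF (λ ())

  mutual
    occT : ∀ {n} → ℕ → Term n → Set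
    occT i (var _)    = ⊥
    occT i (con j)    = i ≡ j
    occT i (app f ts) = occTs i ts

    occTs : ∀ {n k} → ℕ → Vec (Term n) k → Set
    occTs i []       = ⊥
    occTs i (t ∷ ts) = occT i t ⊎ occTs i ts

  occF : ∀ {n} → ℕ → Formula n → Set
  occF i (atom R ts) = occTs i ts
  occF i ⊤'          = ⊥
  occF i ⊥'          = ⊥
  occF i (φ ∧' ψ)    = occF i φ ⊎ occF i ψ
  occF i (φ ∨' ψ)    = occF i φ ⊎ occF i ψ
  occF i (φ ⇒ ψ)     = occF i φ ⊎ occF i ψ
  occF i (∀' φ)      = occF i φ
  occF i (∃' φ)      = occF i φ

  SentSet : Set₁
  SentSet = Sentence → Set

  ∅ : SentSet
  ∅ _ = ⊥

  ⟨_⟩ : Sentence → SentSet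
  ⟨ φ ⟩ χ = χ ≡ φ

  _∪_ : SentSet → SentSet → SentSet
  (A ∪ B) χ = A χ ⊎ B χ

  _∖_ : SentSet → Sentence → SentSet
  (A ∖ φ) χ = A χ × ¬ (χ ≡ φ)

  -- Der Δ φ : derivation trees of N BQL_CD with root φ whose set of open
  -- (undischarged) assumptions is exactly Δ.
  data Der : SentSet → Sentence → Set₁ where
    hyp  : (φ : Sentence) → Der ⟨ φ ⟩ φ
    ⊤I   : Der ∅ ⊤'
    ⊥E   : ∀ {Δ φ} → Der Δ ⊥' → Der Δ φ
    ∧I   : ∀ {Δ₁ Δ₂ φ ψ} → Der Δ₁ φ → Der Δ₂ ψ → Der (Δ₁ ∪ Δ₂) (φ ∧' ψ)
    ∧E₁  : ∀ {Δ φ ψ} → Der Δ (φ ∧' ψ) → Der Δ φ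
    ∧E₂  : ∀ {Δ φ ψ} → Der Δ (φ ∧' ψ) → Der Δ ψ
    ∨I₁  : ∀ {Δ φ} (ψ : Sentence) → Der Δ φ → Der Δ (φ ∨' ψ)
    ∨I₂  : ∀ {Δ ψ} (φ : Sentence) → Der Δ ψ → Der Δ (φ ∨' ψ)
    ∨E   : ∀ {Δ₀ Δ₁ Δ₂ φ ψ χ} → Der Δ₀ (φ ∨' ψ) → Der Δ₁ χ → Der Δ₂ χ →
           Der (Δ₀ ∪ ((Δ₁ ∖ φ) ∪ (Δ₂ ∖ ψ))) χ
    ⇒I   : ∀ {Δ ψ} (φ : Sentence) → Der Δ ψ → Der (Δ ∖ φ) (φ ⇒ ψ)
    iTrans : ∀ {Δ₁ Δ₂ φ ψ χ} → Der Δ₁ (φ ⇒ ψ) → Der Δ₂ (ψ ⇒ χ) →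
             Der (Δ₁ ∪ Δ₂) (φ ⇒ χ)
    i∧I  : ∀ {Δ₁ Δ₂ φ ψ χ} → Der Δ₁ (φ ⇒ ψ) → Der Δ₂ (φ ⇒ χ) →
           Der (Δ₁ ∪ Δ₂) (φ ⇒ ψ ∧' χ)
    i∨E  : ∀ {Δ₁ Δ₂ φ ψ χ} → Der Δ₁ (φ ⇒ χ) → Der Δ₂ (ψ ⇒ χ) →
           Der (Δ₁ ∪ Δ₂) (φ ∨' ψ ⇒ χ)
    i∀I  : ∀ {Δ} {φ : Sentence} {ψ : Formula 1} →
           Der Δ (∀' (wk φ ⇒ ψ)) → Der Δ (φ ⇒ ∀' ψ)
    i∃E  : ∀ {Δ} {φ : Formula 1} {ψ : Sentence} →
           Der Δ (∀' (φ ⇒ wk ψ)) → Der Δ (∃' φ ⇒ ψ)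
    ∀I   : ∀ {Δ} (i : ℕ) {φ : Formula 1} →
           ¬ occF i φ → (∀ χ → Δ χ → ¬ occF i χ) →
           Der Δ (φ [ con i ]) → Der Δ (∀' φ)
    ∀E   : ∀ {Δ} {φ : Formula 1} (t : Term 0) → Der Δ (∀' φ) → Der Δ (φ [ t ])
    CD   : ∀ {Δ} {φ : Sentence} {ψ : Formula 1} →
           Der Δ (∀' (wk φ ∨' ψ)) → Der Δ (φ ∨' ∀' ψ)
    ∃I   : ∀ {Δ} {φ : Formula 1} (t : Term 0) → Der Δ (φ [ t ]) → Der Δ (∃' φ)
    ∃E   : ∀ {Δ₀ Δ₁} (i : ℕ) {φ : Formula 1} {ψ : Sentence} →
           Der Δ₀ (∃' φ) → Der Δ₁ ψ →
           ¬ occF i φ → ¬ occF i ψ →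
           (∀ χ → Δ₁ χ → ¬ (χ ≡ φ [ con i ]) → ¬ occF i χ) →
           Der (Δ₀ ∪ (Δ₁ ∖ (φ [ con i ]))) ψ

  _⊢_ : SentSet → Sentence → Set₁
  Γ ⊢ φ = Σ SentSet λ Δ → Der Δ φ × (∀ χ → Δ χ → Γ χ)

  record Sat (Θ : SentSet) : Set₁ where
    field
      consistent : ¬ Θ ⊥'
      closed     : ∀ φ → Θ ⊢ φ → Θ φ
      prime      : ∀ φ ψ → Θ (φ ∨' ψ) → Θ φ ⊎ Θ ψ
      witness    : ∀ (φ : Formula 1) → Θ (∃' φ) → ∃ λ (t : Term 0) → Θ (φ [ t ])
      ω-rule     : ∀ (φ : Formula 1) → (∀ (t : Term 0) → Θ (φ [ t ])) → Θ (∀' φ)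

  _≺_ : SentSet → SentSet → Set
  S ≺ G = ∀ φ ψ → S (φ ⇒ ψ) → G φ → G ψ

  _⊆_ : SentSet → SentSet → Set
  S ⊆ G = ∀ φ → S φ → G φ

-- The proof only uses that both theories are closed under derivability.
-- Since ⊤ can be introduced at a leaf as an already-discharged assumption,
-- every deductively closed theory contains ⊤.  Since →-Int may discharge
-- an assumption that does not occur, a deductively closed theory that
-- contains φ also contains ψ → φ for every ψ.  Given φ ∈ Σ we therefore
-- have ⊤ → φ ∈ Σ and ⊤ ∈ Γ, and the definition of Σ ≺ Γ yields φ ∈ Γ.
module Submission where

open import Defs
open import Data.Product using (_,_)
open import Relation.Binary.PropositionalEquality using (subst; sym)

module DeductiveClosure (L : Language) where
  open Syntax L

  Closed : SentSet → Set₁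
  Closed Θ = ∀ φ → Θ ⊢ φ → Θ φ

  closed-⊤ : ∀ {Θ} → Closed Θ → Θ ⊤'
  closed-⊤ closed = closed ⊤' (∅ , ⊤I , λ _ ())

  -- Vacuous →-Int: from φ derive ψ → φ; the only possible open
  -- assumption is φ itself, which is in Θ.
  closed-weaken : ∀ {Θ} → Closed Θ → ∀ ψ {φ} → Θ φ → Θ (ψ ⇒ φ)
  closed-weaken {Θ} closed ψ {φ} Θφ =
    closed (ψ ⇒ φ) (⟨ φ ⟩ ∖ ψ , ⇒I ψ (hyp φ) , open-in-Θ)
    where
    open-in-Θ : ∀ χ → (⟨ φ ⟩ ∖ ψ) χ → Θ χ
    open-in-Θ χ (χ≡φ , _) = subst Θ (sym χ≡φ) Θφ

  ≺⇒⊆ : ∀ {S G} → Closed S → Closed G → S ≺ G → S ⊆ G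
  ≺⇒⊆ closedS closedG S≺G φ Sφ =
    S≺G ⊤' φ (closed-weaken closedS ⊤' Sφ) (closed-⊤ closedG)

mainTheorem13 : (L : Language) (S G : Syntax.SentSet L) →
                Syntax.Sat L S → Syntax.Sat L G →
                Syntax._≺_ L S G → Syntax._⊆_ L S G
mainTheorem13 L S G satS satG =
  DeductiveClosure.≺⇒⊆ L (Syntax.Sat.closed satS) (Syntax.Sat.closed satG)
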